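{- Let $k$ be a positive integer and let $D$ be a digraph with a partition $\{X,Y\}$ of $V(D)$ such that $D[X]$ is traceable and $Y$ is a stable set of $D$. Then $\alpha_k(D)\geq |Y|+\min\{|X|,k-1\}$. Moreover, if $|X|<k$, then $\alpha_k(D)=|V(D)|$.
   Context: Digraphs have no loops and no parallel arcs. A digraph is traceable if it has a Hamiltonian (directed) path. A stable set of $D$ is a stable set of its underlying undirected graph. A $k$-partial coloring is a set of $k$ pairwise disjoint stable sets (empty allowed); its weight is the sum of the sizes of its classes, and $\alpha_k(D)$ is the maximum weight of a $k$-partial coloring of $D$. -}

module Defs where

open import Data.Nat using (ℕ; _≤_)
open import Data.Bool using (Bool; true; false)
open import Data.Fin using (Fin)
open import Data.Fin.Subset using (Subset; _∈_; ∣_∣)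
open import Data.List using (List; []; _∷_; map; allFin)
open import Data.Nat.ListAction using (sum)
import Data.List.Membership.Propositional as LMem
open import Data.List.Relation.Unary.All using (All)
open import Data.List.Relation.Unary.Unique.Propositional using (Unique)
open import Data.Product using (Σ; _×_)
open import Data.Empty using (⊥)
open import Relation.Binary.PropositionalEquality using (_≡_; _≢_)

-- A digraph on vertex set Fin n: a Boolean arc relation without loops.
-- (Parallel arcs are impossible in this representation.)
record Digraph (n : ℕ) : Set where
  field
    arc   : Fin n → Fin n → Bool
    loopless : ∀ v → arc v v ≡ false
open Digraph public

data ArcPath {n : ℕ} (D : Digraph n) : List (Fin n) → Set where
  []  : ArcPath D []
  [_] : ∀ v → ArcPath D (v ∷ [])
  _∷_ : ∀ {u v vs} → arc D u v ≡ true → ArcPath D (v ∷ vs) → ArcPath D (u ∷ v ∷ vs)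

TraceableOn : {n : ℕ} → Digraph n → Subset n → Set
TraceableOn {n} D X =
  Σ (List (Fin n)) λ p →
    Unique p × All (λ v → v ∈ X) p × (∀ v → v ∈ X → v LMem.∈ p) × ArcPath D p

Stable : {n : ℕ} → Digraph n → Subset n → Set
Stable D S = ∀ u v → u ∈ S → v ∈ S → arc D u v ≡ false

record PartialColoring {n : ℕ} (k : ℕ) (D : Digraph n) : Set where
  field
    class    : Fin k → Subset n
    stable   : ∀ i → Stable D (class i)
    disjoint : ∀ i j → i ≢ j → ∀ x → x ∈ class i → x ∈ class j → ⊥
open PartialColoring public

weight : {n k : ℕ} {D : Digraph n} → PartialColoring k D → ℕ
weight {k = k} C = sum (map (λ i → ∣ class C i ∣) (allFin k))

IsAlpha : {n : ℕ} → ℕ → Digraph n → ℕ → Set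
IsAlpha k D m =
  Σ (PartialColoring k D) (λ C → weight C ≡ m) × (∀ (C : PartialColoring k D) → weight C ≤ m)

-- A stable set Y together with k - 1 singleton classes taken from X is a k-partial
-- colouring of weight |Y| + min(|X|, k - 1), since a single vertex is stable in a
-- loopless digraph. Conversely the classes of any partial colouring are pairwise
-- disjoint, so its weight is at most |V(D)|; when |X| < k the colouring above already
-- covers every vertex.
module Submission where

open import Defs
open import Data.Nat using (ℕ; _≤_; _<_; _+_; _∸_; _⊓_; zero; suc; s≤s)
open import Data.Nat.Properties
  using (+-suc; ≤-antisym; m∸n+n≡m; m≤n⇒m⊓n≡m; module ≤-Reasoning)
open import Data.Nat.ListAction using (sum)
open import Data.Fin using (Fin; zero; suc)
open import Data.Fin.Properties using (suc-injective)
open import Data.Fin.Subset using (Subset; ∁; ∣_∣; _∈_; _∪_; ⊥; inside; outside)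
open import Data.Fin.Subset.Properties using (∉⊥; x∈∁p⇒x∉p; x∈p∪q⁻; ∣⊥∣≡0; ∣p∣≤n; ∣∁p∣≡n∸∣p∣)
open import Data.Vec using ([]; _∷_; here; there)
open import Data.List using (_∷_; map; allFin)
open import Data.List.Properties using (map-tabulate)
open import Data.Product using (_×_; _,_; Σ-syntax)
open import Data.Sum using (inj₁; inj₂)
open import Data.Empty using (⊥-elim) renaming (⊥ to Empty)
open import Function using (_∘_; id)
open import Relation.Binary.PropositionalEquality
  using (_≡_; _≢_; refl; sym; trans; cong; cong₂; subst; module ≡-Reasoning)

private
  variable
    n k : ℕ

map-allFin-suc : {A : Set} (f : Fin (suc k) → A) →
                 map f (allFin (suc k)) ≡ f zero ∷ map (f ∘ suc) (allFin k)
map-allFin-suc f = cong (f zero ∷_) (trans (map-tabulate suc f) (sym (map-tabulate id (f ∘ suc))))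

∣∁p∣+∣p∣≡n : (p : Subset n) → ∣ ∁ p ∣ + ∣ p ∣ ≡ n
∣∁p∣+∣p∣≡n p = trans (cong (_+ ∣ p ∣) (∣∁p∣≡n∸∣p∣ p)) (m∸n+n≡m (∣p∣≤n p))

Disjoint : Subset n → Subset n → Set
Disjoint p q = ∀ x → x ∈ p → x ∈ q → Empty

Disjoint-∷⁻ : ∀ {a b} {p q : Subset n} → Disjoint (a ∷ p) (b ∷ q) → Disjoint p q
Disjoint-∷⁻ p#q x x∈p x∈q = p#q (suc x) (there x∈p) (there x∈q)

∣p∪q∣≡∣p∣+∣q∣ : (p q : Subset n) → Disjoint p q → ∣ p ∪ q ∣ ≡ ∣ p ∣ + ∣ q ∣
∣p∪q∣≡∣p∣+∣q∣ []            []            _   = refl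
∣p∪q∣≡∣p∣+∣q∣ (inside  ∷ p) (inside  ∷ q) p#q = ⊥-elim (p#q zero here here)
∣p∪q∣≡∣p∣+∣q∣ (inside  ∷ p) (outside ∷ q) p#q = cong suc (∣p∪q∣≡∣p∣+∣q∣ p q (Disjoint-∷⁻ p#q))
∣p∪q∣≡∣p∣+∣q∣ (outside ∷ p) (inside  ∷ q) p#q =
  trans (cong suc (∣p∪q∣≡∣p∣+∣q∣ p q (Disjoint-∷⁻ p#q))) (sym (+-suc ∣ p ∣ ∣ q ∣))
∣p∪q∣≡∣p∣+∣q∣ (outside ∷ p) (outside ∷ q) p#q = ∣p∪q∣≡∣p∣+∣q∣ p q (Disjoint-∷⁻ p#q)

totalSize : (Fin k → Subset n) → ℕ
totalSize {k} S = sum (map (λ i → ∣ S i ∣) (allFin k))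

totalSize-suc : (S : Fin (suc k) → Subset n) → totalSize S ≡ ∣ S zero ∣ + totalSize (S ∘ suc)
totalSize-suc S = cong sum (map-allFin-suc (λ i → ∣ S i ∣))

totalSize-⊥ : totalSize {k} (λ _ → ⊥ {n}) ≡ 0
totalSize-⊥ {zero}      = refl
totalSize-⊥ {suc k} {n} =
  trans (totalSize-suc {k} {n} (λ _ → ⊥)) (cong₂ _+_ (∣⊥∣≡0 n) (totalSize-⊥ {k} {n}))

⋃ᶠ : (Fin k → Subset n) → Subset n
⋃ᶠ {zero}  S = ⊥
⋃ᶠ {suc k} S = S zero ∪ ⋃ᶠ (S ∘ suc)

x∈⋃ᶠ⁻ : (S : Fin k → Subset n) {x : Fin n} → x ∈ ⋃ᶠ S → Σ[ i ∈ Fin k ] x ∈ S i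
x∈⋃ᶠ⁻ {zero}  S x∈⋃S = ⊥-elim (∉⊥ x∈⋃S)
x∈⋃ᶠ⁻ {suc k} S x∈⋃S with x∈p∪q⁻ (S zero) (⋃ᶠ (S ∘ suc)) x∈⋃S
... | inj₁ x∈S₀ = zero , x∈S₀
... | inj₂ x∈⋃S′ with x∈⋃ᶠ⁻ (S ∘ suc) x∈⋃S′
...   | i , x∈Sᵢ = suc i , x∈Sᵢ

PairwiseDisjoint : (Fin k → Subset n) → Set
PairwiseDisjoint S = ∀ i j → i ≢ j → Disjoint (S i) (S j)

totalSize≡∣⋃ᶠ∣ : (S : Fin k → Subset n) → PairwiseDisjoint S → totalSize S ≡ ∣ ⋃ᶠ S ∣
totalSize≡∣⋃ᶠ∣ {zero}  {n} S _ = sym (∣⊥∣≡0 n)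
totalSize≡∣⋃ᶠ∣ {suc k}     S S# = begin
  totalSize S                          ≡⟨ totalSize-suc S ⟩
  ∣ S zero ∣ + totalSize (S ∘ suc)     ≡⟨ cong (∣ S zero ∣ +_) (totalSize≡∣⋃ᶠ∣ (S ∘ suc) S′#) ⟩
  ∣ S zero ∣ + ∣ ⋃ᶠ (S ∘ suc) ∣        ≡⟨ sym (∣p∪q∣≡∣p∣+∣q∣ (S zero) (⋃ᶠ (S ∘ suc)) S₀#⋃S′) ⟩
  ∣ ⋃ᶠ S ∣                             ∎
  where
  open ≡-Reasoning
  S′# : PairwiseDisjoint (S ∘ suc)
  S′# i j i≢j = S# (suc i) (suc j) (i≢j ∘ suc-injective)
  S₀#⋃S′ : Disjoint (S zero) (⋃ᶠ (S ∘ suc))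
  S₀#⋃S′ x x∈S₀ x∈⋃S′ with x∈⋃ᶠ⁻ (S ∘ suc) x∈⋃S′
  ... | i , x∈Sᵢ = S# zero (suc i) (λ ()) x x∈S₀ x∈Sᵢ

weight≤n : {D : Digraph n} (C : PartialColoring k D) → weight C ≤ n
weight≤n C =
  subst (_≤ _) (sym (totalSize≡∣⋃ᶠ∣ (class C) (disjoint C))) (∣p∣≤n (⋃ᶠ (class C)))

-- The first k elements of p, each in its own class; the remaining classes are empty.
spread : Subset n → (k : ℕ) → Fin k → Subset n
spread []            k       j       = []
spread (outside ∷ p) k       j       = outside ∷ spread p k j
spread (inside  ∷ p) (suc k) zero    = inside ∷ ⊥
spread (inside  ∷ p) (suc k) (suc j) = outside ∷ spread p k j

spread-⊆ : (p : Subset n) (j : Fin k) {x : Fin n} → x ∈ spread p k j → x ∈ p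
spread-⊆ (outside ∷ p) j       (there x∈) = there (spread-⊆ p j x∈)
spread-⊆ (inside  ∷ p) zero    here       = here
spread-⊆ (inside  ∷ p) zero    (there x∈) = ⊥-elim (∉⊥ x∈)
spread-⊆ (inside  ∷ p) (suc j) (there x∈) = there (spread-⊆ p j x∈)

spread-subsingleton : (p : Subset n) (j : Fin k) {x y : Fin n} →
                      x ∈ spread p k j → y ∈ spread p k j → x ≡ y
spread-subsingleton (outside ∷ p) j       (there x∈) (there y∈) = cong suc (spread-subsingleton p j x∈ y∈)
spread-subsingleton (inside  ∷ p) zero    here       here       = refl
spread-subsingleton (inside  ∷ p) zero    _          (there y∈) = ⊥-elim (∉⊥ y∈)
spread-subsingleton (inside  ∷ p) zero    (there x∈) _          = ⊥-elim (∉⊥ x∈)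
spread-subsingleton (inside  ∷ p) (suc j) (there x∈) (there y∈) = cong suc (spread-subsingleton p j x∈ y∈)

spread-disjoint : (p : Subset n) → PairwiseDisjoint (spread p k)
spread-disjoint (outside ∷ p) i       j       i≢j (suc x) (there x∈) (there x∈′) =
  spread-disjoint p i j i≢j x x∈ x∈′
spread-disjoint (inside  ∷ p) zero    zero    i≢j _       _          _           = i≢j refl
spread-disjoint (inside  ∷ p) zero    (suc j) _   (suc x) (there x∈) _           = ∉⊥ x∈
spread-disjoint (inside  ∷ p) (suc i) zero    _   (suc x) _          (there x∈′) = ∉⊥ x∈′
spread-disjoint (inside  ∷ p) (suc i) (suc j) i≢j (suc x) (there x∈) (there x∈′) =
  spread-disjoint p i j (i≢j ∘ cong suc) x x∈ x∈′

totalSize-spread : (p : Subset n) (k : ℕ) → totalSize (spread p k) ≡ ∣ p ∣ ⊓ k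
totalSize-spread []            k       = totalSize-⊥ {k} {0}
totalSize-spread (outside ∷ p) k       = totalSize-spread p k
totalSize-spread (inside  ∷ p) zero    = refl
totalSize-spread {suc n} (inside ∷ p) (suc k) =
  trans (totalSize-suc (spread (inside ∷ p) (suc k)))
        (cong₂ (λ a b → suc a + b) (∣⊥∣≡0 n) (totalSize-spread p k))

subsingleton-stable : (D : Digraph n) {S : Subset n} →
                      (∀ {x y} → x ∈ S → y ∈ S → x ≡ y) → Stable D S
subsingleton-stable D S≤1 u v u∈ v∈ with S≤1 u∈ v∈
... | refl = loopless D u

stableWithSingletons : (D : Digraph n) (X : Subset n) → Stable D (∁ X) → (k : ℕ) →
                       Σ[ C ∈ PartialColoring (suc k) D ] weight C ≡ ∣ ∁ X ∣ + ∣ X ∣ ⊓ k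
stableWithSingletons D X ∁X-stable k =
  C , trans (totalSize-suc classes) (cong (∣ ∁ X ∣ +_) (totalSize-spread X k))
  where
  classes : Fin (suc k) → Subset _
  classes zero    = ∁ X
  classes (suc j) = spread X k j

  classes-disjoint : PairwiseDisjoint classes
  classes-disjoint zero    zero    i≢j _ _   _   = i≢j refl
  classes-disjoint zero    (suc j) _   _ x∈ x∈′ = x∈∁p⇒x∉p x∈ (spread-⊆ X j x∈′)
  classes-disjoint (suc i) zero    _   _ x∈ x∈′ = x∈∁p⇒x∉p x∈′ (spread-⊆ X i x∈)
  classes-disjoint (suc i) (suc j) i≢j x x∈ x∈′ = spread-disjoint X i j (i≢j ∘ cong suc) x x∈ x∈′

  C : PartialColoring (suc k) D
  C = record
    { class    = classes
    ; stable   = λ { zero → ∁X-stable ; (suc j) → subsingleton-stable D (spread-subsingleton X j) }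
    ; disjoint = classes-disjoint
    }

lemma2 : (k : ℕ) → 1 ≤ k → {n : ℕ} → (D : Digraph n) → (X : Subset n) →
         TraceableOn D X → Stable D (∁ X) → (m : ℕ) → IsAlpha k D m →
         (∣ ∁ X ∣ + (∣ X ∣ ⊓ (k ∸ 1)) ≤ m) × (∣ X ∣ < k → m ≡ n)
lemma2 (suc k) _ {n} D X _ ∁X-stable m ((C₀ , wC₀≡m) , maximal) = lower , exact
  where
  lower : ∣ ∁ X ∣ + ∣ X ∣ ⊓ k ≤ m
  lower with stableWithSingletons D X ∁X-stable k
  ... | C , wC≡ = subst (_≤ m) wC≡ (maximal C)

  exact : ∣ X ∣ < suc k → m ≡ n
  exact (s≤s ∣X∣≤k) = ≤-antisym (subst (_≤ n) wC₀≡m (weight≤n C₀)) (begin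
    n                          ≡⟨ sym (∣∁p∣+∣p∣≡n X) ⟩
    ∣ ∁ X ∣ + ∣ X ∣            ≡⟨ cong (∣ ∁ X ∣ +_) (sym (m≤n⇒m⊓n≡m ∣X∣≤k)) ⟩
    ∣ ∁ X ∣ + ∣ X ∣ ⊓ k        ≤⟨ lower ⟩
    m                          ∎)
    where open ≤-Reasoning
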